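{- Let $M_n$ denote the $n$th Motzkin number. The set $\{n \in \mathbb{N} : M_n \equiv 0 \pmod 3\}$ has asymptotic density $1$.
   Context: $\mathbb{N} = \{0,1,2,\dots\}$. The Motzkin numbers are $M_n = \sum_{k \geq 0} \binom{n}{2k} C_k$ for $n \in \mathbb{N}$, where $C_k = \frac{1}{k+1}\binom{2k}{k}$ is the $k$th Catalan number. The asymptotic density of a subset $A \subseteq \mathbb{N}$ is $\lim_{N\to\infty} \frac{1}{N}\#\{n \in A : n \leq N\}$, if this limit exists. -}

module Defs where

open import Data.Nat using (ℕ; zero; suc; _+_; _*_; _/_; _%_)
open import Data.Nat.Combinatorics using (_C_)
open import Data.Nat.Divisibility using (_∣_; _∣?_)
open import Relation.Nullary using (yes; no)

sumTo : ℕ → (ℕ → ℕ) → ℕ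
sumTo zero    f = f zero
sumTo (suc n) f = sumTo n f + f (suc n)

-- Catalan number C_k = binom(2k,k)/(k+1)  (exact division)
catalan : ℕ → ℕ
catalan k = ((2 * k) C k) / suc k

-- Motzkin number M_n = Σ_{k ≥ 0} binom(n,2k) C_k.
-- Terms with 2k > n vanish, so summing over k ≤ n is the full sum.
motzkin : ℕ → ℕ
motzkin n = sumTo n (λ k → (n C (2 * k)) * catalan k)

ind3 : ℕ → ℕ
ind3 n with 3 ∣? motzkin n
... | yes _ = 1
... | no  _ = 0

count : ℕ → ℕ
count N = sumTo N ind3

-- Modulo 3 we have 1 + x + x² = (1 - x)², so the trinomial coefficient T(n, j) (the coefficient
-- of xⁿ⁺ʲ in (1 + x + x²)ⁿ) is ±C(2n, n + j). Writing the Catalan number as C(2k, k) - C(2k, k + 1)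
-- gives Mₙ = T(n, 0) - T(n, 2), hence Mₙ ≡ ±(C(2n, n) - C(2n, n + 2)) (mod 3).
-- By Lucas' theorem, deleting the last base-3 digit of m turns C(2m + u, m + v) mod 3 into
-- C(2m' + u', m' + v') mod 3 times a binomial coefficient of digits. Following these transitions
-- from (u, v) = (0, 0), (0, 1), (1, 1) shows that each of these is nonzero mod 3 for at most 2ʲ of
-- the m < 3ʲ, hence 3 ∤ Mₙ for at most 4·2ʲ of the n < 3ʲ⁺¹: a vanishing proportion.
module Submission where

open import Defs
open import Data.Nat using (ℕ; zero; suc; _+_; _*_; _∸_; _^_; _≤_; _<_; z≤n; s≤s; z<s; s<s; ∣_-_∣; _/_)
open import Data.Nat.Properties
open import Data.Nat.Combinatorics using (_C_; nCk+nC[k+1]≡[n+1]C[k+1]; k>n⇒nCk≡0; nCk≡nC[n∸k]; nC1≡n)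
open import Data.Nat.DivMod using (_mod_; _%_; %-distribˡ-+; %-distribˡ-*; m*n/n≡m; m≡m%n+[m/n]*n; m%n<n)
open import Data.Nat.Divisibility using (_∣_; _∣?_; n∣m⇒m%n≡0; m%n≡0⇒n∣m)
open import Data.Nat.Tactic.RingSolver using (solve-∀)
open import Data.Fin using (Fin; toℕ) renaming (zero to 0F; suc to 1+F)
open import Data.Fin.Properties using (all?; toℕ-injective; toℕ-fromℕ<) renaming (_≟_ to _≟₃_)
open import Data.Product using (Σ; _,_; _×_)
open import Data.Sum using (inj₁; inj₂)
open import Algebra.Properties.CommutativeSemigroup +-commutativeSemigroup
  using () renaming (interchange to +-interchange)
open import Relation.Nullary using (yes; no; contradiction)
open import Relation.Nullary.Decidable using (from-yes)
open import Relation.Binary.PropositionalEquality hiding ([_])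
open ≡-Reasoning

∑< : ℕ → (ℕ → ℕ) → ℕ
∑< zero    f = 0
∑< (suc n) f = ∑< n f + f n

sumTo≡∑< : ∀ n f → sumTo n f ≡ ∑< (suc n) f
sumTo≡∑< zero    f = refl
sumTo≡∑< (suc n) f = cong (_+ f (suc n)) (sumTo≡∑< n f)

∑<-cong : ∀ n {f g} → (∀ i → f i ≡ g i) → ∑< n f ≡ ∑< n g
∑<-cong zero    f≡g = refl
∑<-cong (suc n) f≡g = cong₂ _+_ (∑<-cong n f≡g) (f≡g n)

∑<-mono : ∀ n {f g} → (∀ i → f i ≤ g i) → ∑< n f ≤ ∑< n g
∑<-mono zero    f≤g = z≤n
∑<-mono (suc n) f≤g = +-mono-≤ (∑<-mono n f≤g) (f≤g n)

∑<-monoˡ : ∀ f {m n} → m ≤ n → ∑< m f ≤ ∑< n f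
∑<-monoˡ f {n = zero}  z≤n = z≤n
∑<-monoˡ f {n = suc n} m≤1+n with m≤n⇒m<n∨m≡n m≤1+n
... | inj₁ (s≤s m≤n) = ≤-trans (∑<-monoˡ f m≤n) (m≤m+n (∑< n f) (f n))
... | inj₂ refl      = ≤-refl

∑<-+ : ∀ n f g → ∑< n (λ i → f i + g i) ≡ ∑< n f + ∑< n g
∑<-+ zero    f g = refl
∑<-+ (suc n) f g = trans (cong (_+ (f n + g n)) (∑<-+ n f g)) (+-interchange (∑< n f) (∑< n g) (f n) (g n))

∑<-*ˡ : ∀ n c f → ∑< n (λ i → c * f i) ≡ c * ∑< n f
∑<-*ˡ zero    c f = sym (*-zeroʳ c)
∑<-*ˡ (suc n) c f = trans (cong (_+ c * f n) (∑<-*ˡ n c f)) (sym (*-distribˡ-+ c (∑< n f) (f n)))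

∑<-const : ∀ n c → ∑< n (λ _ → c) ≡ n * c
∑<-const zero    c = refl
∑<-const (suc n) c = trans (cong (_+ c) (∑<-const n c)) (+-comm (n * c) c)

∑<-zero : ∀ n → ∑< n (λ _ → 0) ≡ 0
∑<-zero n = trans (∑<-const n 0) (*-zeroʳ n)

∑<-head : ∀ n f → ∑< (suc n) f ≡ f 0 + ∑< n (λ i → f (suc i))
∑<-head zero    f = +-comm 0 (f 0)
∑<-head (suc n) f =
  trans (cong (_+ f (suc n)) (∑<-head n f)) (+-assoc (f 0) (∑< n (λ i → f (suc i))) (f (suc n)))

∑<-shifted : ∀ n {g a c} → g 0 ≡ a 0 → (∀ k → g (suc k) ≡ a (suc k) + c k) →
             ∑< (suc n) g ≡ ∑< (suc n) a + ∑< n c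
∑<-shifted zero    g≡a _ = trans g≡a (sym (+-identityʳ _))
∑<-shifted (suc n) {g} {a} {c} g≡a g≡a+c = begin
  ∑< (suc n) g + g (suc n)                   ≡⟨ cong₂ _+_ (∑<-shifted n g≡a g≡a+c) (g≡a+c n) ⟩
  ∑< (suc n) a + ∑< n c + (a (suc n) + c n)  ≡⟨ +-interchange (∑< (suc n) a) (∑< n c) (a (suc n)) (c n) ⟩
  ∑< (suc (suc n)) a + ∑< (suc n) c          ∎

∑<-digits : ∀ {h x y z} →
            (∀ a → h (3 * a) ≤ x a) → (∀ a → h (1 + 3 * a) ≤ y a) → (∀ a → h (2 + 3 * a) ≤ z a) →
            ∀ n → ∑< (3 * n) h ≤ ∑< n x + ∑< n y + ∑< n z
∑<-digits                 h≤x h≤y h≤z zero    = z≤n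
∑<-digits {h} {x} {y} {z} h≤x h≤y h≤z (suc n) =
  subst (_≤ ∑< (suc n) x + ∑< (suc n) y + ∑< (suc n) z) (cong (λ m → ∑< m h) (sym (3[1+n]≡3+3n n)))
    (≤-trans (+-mono-≤ (+-mono-≤ (+-mono-≤ (∑<-digits h≤x h≤y h≤z n) (h≤x n)) (h≤y n)) (h≤z n))
             (≤-reflexive (regroup (∑< n x) (∑< n y) (∑< n z) (x n) (y n) (z n))))
  where
  3[1+n]≡3+3n : ∀ n → 3 * suc n ≡ 3 + 3 * n
  3[1+n]≡3+3n = solve-∀
  regroup : ∀ X Y Z a b c → X + Y + Z + a + b + c ≡ X + a + (Y + b) + (Z + c)
  regroup = solve-∀

m+o≡1+n⇒∣m-n∣<o : ∀ m n {o} → 1 ≤ o → m + o ≡ suc n → ∣ m - n ∣ < o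
m+o≡1+n⇒∣m-n∣<o zero    n       _                 refl = ≤-refl
m+o≡1+n⇒∣m-n∣<o (suc m) zero    (s≤s {n = o} z≤n) eq   =
  contradiction (trans (sym (+-suc m o)) (suc-injective eq)) λ ()
m+o≡1+n⇒∣m-n∣<o (suc m) (suc n) 1≤o               eq   = m+o≡1+n⇒∣m-n∣<o m n 1≤o (suc-injective eq)

2^n*[n+2]≤2*3^n : ∀ n → 2 ^ n * (n + 2) ≤ 2 * 3 ^ n
2^n*[n+2]≤2*3^n zero    = ≤-refl
2^n*[n+2]≤2*3^n (suc n) = ≤-trans (≤-reflexive (split (2 ^ n) n))
  (≤-trans (+-mono-≤ (*-monoʳ-≤ 2 (2^n*[n+2]≤2*3^n n)) (*-monoʳ-≤ 2 (^-monoˡ-≤ n (s≤s (s≤s z≤n)))))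
           (≤-reflexive (collect (3 ^ n))))
  where
  split : ∀ x n → 2 * x * (suc n + 2) ≡ 2 * (x * (n + 2)) + 2 * x
  split = solve-∀
  collect : ∀ y → 2 * (2 * y) + 2 * y ≡ 2 * (3 * y)
  collect = solve-∀

K*2^n≤3^n : ∀ K n → 2 * K ≤ n → K * 2 ^ n ≤ 3 ^ n
K*2^n≤3^n K n 2K≤n = *-cancelˡ-≤ 2 (≤-trans (≤-reflexive (swap K (2 ^ n)))
  (≤-trans (*-monoʳ-≤ (2 ^ n) (≤-trans 2K≤n (m≤m+n n 2))) (2^n*[n+2]≤2*3^n n)))
  where
  swap : ∀ K x → 2 * (K * x) ≡ x * (2 * K)
  swap = solve-∀

base3-bracket : ∀ N → 0 < N → Σ ℕ λ j → 3 ^ j ≤ N × N < 3 ^ suc j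
base3-bracket (suc zero)    _ = 0 , ≤-refl , s≤s (s≤s z≤n)
base3-bracket (suc (suc n)) _ with base3-bracket (suc n) z<s
... | j , 3^j≤1+n , 1+n<3^[1+j] with suc (suc n) <? 3 ^ suc j
...   | yes 2+n<3^[1+j] = j , m≤n⇒m≤1+n 3^j≤1+n , 2+n<3^[1+j]
...   | no  2+n≮3^[1+j] = suc j , ≤-reflexive (sym 2+n≡3^[1+j]) ,
                          subst (_< 3 ^ suc (suc j)) (sym 2+n≡3^[1+j]) (^-monoʳ-< 3 (s≤s (s≤s z≤n)) (n<1+n (suc j)))
  where
  2+n≡3^[1+j] : suc (suc n) ≡ 3 ^ suc j
  2+n≡3^[1+j] = ≤-antisym 1+n<3^[1+j] (≮⇒≥ 2+n≮3^[1+j])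

pascal : ∀ n k → suc n C suc k ≡ n C k + n C suc k
pascal n k = sym (nCk+nC[k+1]≡[n+1]C[k+1] n k)

pascal² : ∀ n k → suc (suc n) C suc (suc k) ≡ n C k + 2 * (n C suc k) + n C suc (suc k)
pascal² n k = begin
  suc (suc n) C suc (suc k)                            ≡⟨ pascal (suc n) (suc k) ⟩
  suc n C suc k + suc n C suc (suc k)                  ≡⟨ cong₂ _+_ (pascal n k) (pascal n (suc k)) ⟩
  (n C k + n C suc k) + (n C suc k + n C suc (suc k))  ≡⟨ regroup (n C k) (n C suc k) (n C suc (suc k)) ⟩
  n C k + 2 * (n C suc k) + n C suc (suc k)            ∎
  where
  regroup : ∀ a b c → (a + b) + (b + c) ≡ a + 2 * b + c
  regroup = solve-∀

C-symmetric : ∀ m n → (m + n) C m ≡ (m + n) C n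
C-symmetric m n = trans (nCk≡nC[n∸k] (m≤m+n m n)) (cong ((m + n) C_) (m+n∸m≡n m n))

central-pascal : ∀ n → 2 * suc n C suc n ≡ 2 * (2 * n C n) + 2 * (2 * n C suc n)
central-pascal n = begin
  2 * suc n C suc n                      ≡⟨ cong (_C suc n) (2[1+n]≡1+m n) ⟩
  suc m C suc n                          ≡⟨ pascal m n ⟩
  m C n + m C suc n                      ≡⟨ cong (_+ m C suc n) (C-symmetric n (suc n)) ⟩
  m C suc n + m C suc n                  ≡⟨ cong (m C suc n +_) (sym (+-identityʳ (m C suc n))) ⟩
  2 * (m C suc n)                        ≡⟨ cong (λ l → 2 * (l C suc n)) (m≡1+2n n) ⟩
  2 * (suc (2 * n) C suc n)              ≡⟨ cong (2 *_) (pascal (2 * n) n) ⟩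
  2 * (2 * n C n + 2 * n C suc n)        ≡⟨ *-distribˡ-+ 2 (2 * n C n) (2 * n C suc n) ⟩
  2 * (2 * n C n) + 2 * (2 * n C suc n)  ∎
  where
  m : ℕ
  m = n + suc n
  2[1+n]≡1+m : ∀ n → 2 * suc n ≡ suc (n + suc n)
  2[1+n]≡1+m = solve-∀
  m≡1+2n : ∀ n → n + suc n ≡ suc (2 * n)
  m≡1+2n = solve-∀

absorption : ∀ n k → suc k * (suc n C suc k) ≡ suc n * (n C k)
absorption zero    zero    = refl
absorption zero    (suc k) = *-zeroʳ (suc (suc k))
absorption (suc n) zero    = trans (*-identityˡ _) (trans (nC1≡n (suc (suc n))) (sym (*-identityʳ _)))
absorption (suc n) (suc k) = begin
  suc (suc k) * (suc (suc n) C suc (suc k))  ≡⟨ cong (suc (suc k) *_) (pascal (suc n) (suc k)) ⟩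
  suc (suc k) * (X + Y)                      ≡⟨ expand (suc k) X Y ⟩
  suc k * X + X + suc (suc k) * Y            ≡⟨ cong₂ (λ a b → a + X + b) (absorption n k) (absorption n (suc k)) ⟩
  suc n * (n C k) + X + suc n * (n C suc k)  ≡⟨ collect (suc n) (n C k) X (n C suc k) ⟩
  suc n * (n C k + n C suc k) + X            ≡⟨ cong (λ z → suc n * z + X) (sym (pascal n k)) ⟩
  suc n * X + X                              ≡⟨ +-comm (suc n * X) X ⟩
  suc (suc n) * X                            ∎
  where
  X Y : ℕ
  X = suc n C suc k
  Y = suc n C suc (suc k)
  expand : ∀ a x y → suc a * (x + y) ≡ a * x + x + suc a * y
  expand = solve-∀
  collect : ∀ a p x q → a * p + x + a * q ≡ a * (p + q) + x
  collect = solve-∀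

ballot : ∀ k → suc k * (2 * k C suc k) ≡ k * (2 * k C k)
ballot k = +-cancelˡ-≡ (suc k * (2 * k C k)) _ _ (begin
  suc k * (2 * k C k) + suc k * (2 * k C suc k)  ≡⟨ sym (*-distribˡ-+ (suc k) (2 * k C k) (2 * k C suc k)) ⟩
  suc k * (2 * k C k + 2 * k C suc k)            ≡⟨ cong (suc k *_) (sym (pascal (2 * k) k)) ⟩
  suc k * (suc (2 * k) C suc k)                  ≡⟨ absorption (2 * k) k ⟩
  suc (2 * k) * (2 * k C k)                      ≡⟨ split k (2 * k C k) ⟩
  suc k * (2 * k C k) + k * (2 * k C k)          ∎)
  where
  split : ∀ k x → suc (2 * k) * x ≡ suc k * x + k * x
  split = solve-∀

catalan-difference : ∀ k → catalan k + 2 * k C suc k ≡ 2 * k C k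
catalan-difference k = trans (cong (_+ X) catalan≡Y∸X) (m∸n+n≡m X≤Y)
  where
  X Y : ℕ
  X = 2 * k C suc k
  Y = 2 * k C k
  X≤Y : X ≤ Y
  X≤Y = *-cancelˡ-≤ (suc k) (subst (_≤ suc k * Y) (sym (ballot k)) (*-monoˡ-≤ Y (n≤1+n k)))
  [Y∸X]*[1+k]≡Y : (Y ∸ X) * suc k ≡ Y
  [Y∸X]*[1+k]≡Y = begin
    (Y ∸ X) * suc k        ≡⟨ *-comm (Y ∸ X) (suc k) ⟩
    suc k * (Y ∸ X)        ≡⟨ *-distribˡ-∸ (suc k) Y X ⟩
    suc k * Y ∸ suc k * X  ≡⟨ cong (suc k * Y ∸_) (ballot k) ⟩
    Y + k * Y ∸ k * Y      ≡⟨ cong (_∸ k * Y) (+-comm Y (k * Y)) ⟩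
    k * Y + Y ∸ k * Y      ≡⟨ m+n∸m≡n (k * Y) Y ⟩
    Y                      ∎
  catalan≡Y∸X : catalan k ≡ Y ∸ X
  catalan≡Y∸X = trans (cong (_/ suc k) (sym [Y∸X]*[1+k]≡Y)) (m*n/n≡m (Y ∸ X) (suc k))

multinomial : ℕ → ℕ → ℕ → ℕ
multinomial n i k = (n C i) * (i C k)

multinomial-pascal : ∀ n i k → multinomial (suc n) (suc i) (suc k) ≡
                     multinomial n i (suc k) + multinomial n (suc i) (suc k) + multinomial n i k
multinomial-pascal n i k = begin
  (suc n C suc i) * (suc i C suc k)
    ≡⟨ cong (_* (suc i C suc k)) (pascal n i) ⟩
  (n C i + n C suc i) * (suc i C suc k)
    ≡⟨ *-distribʳ-+ (suc i C suc k) (n C i) (n C suc i) ⟩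
  (n C i) * (suc i C suc k) + multinomial n (suc i) (suc k)
    ≡⟨ cong (λ z → (n C i) * z + multinomial n (suc i) (suc k)) (pascal i k) ⟩
  (n C i) * (i C k + i C suc k) + multinomial n (suc i) (suc k)
    ≡⟨ rearrange (n C i) (i C k) (i C suc k) (multinomial n (suc i) (suc k)) ⟩
  multinomial n i (suc k) + multinomial n (suc i) (suc k) + multinomial n i k ∎
  where
  rearrange : ∀ a c d e → a * (c + d) + e ≡ a * d + e + a * c
  rearrange = solve-∀

-- Choose the 2k + j factors of (1 + x + x²)ⁿ that do not contribute x, and the k of them
-- that contribute 1.
trinomialTerm : ℕ → ℕ → ℕ → ℕ
trinomialTerm n j k = multinomial n (2 * k + j) k

trinomial : ℕ → ℕ → ℕ
trinomial n j = ∑< (suc n) (trinomialTerm n j)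

trinomialTerm-vanishes : ∀ n j k → n < 2 * k + j → trinomialTerm n j k ≡ 0
trinomialTerm-vanishes n j k n<2k+j = cong (_* ((2 * k + j) C k)) (k>n⇒nCk≡0 n<2k+j)

trinomial-extend : ∀ n j → ∑< (suc (suc n)) (trinomialTerm n j) ≡ trinomial n j
trinomial-extend n j =
  trans (cong (trinomial n j +_) (trinomialTerm-vanishes n j (suc n) n<2[1+n]+j)) (+-identityʳ (trinomial n j))
  where
  n<2[1+n]+j : n < 2 * suc n + j
  n<2[1+n]+j = ≤-trans (m≤m+n (suc n) (suc n + 0)) (m≤m+n (2 * suc n) j)

trinomialTerm-suc : ∀ n j k → trinomialTerm (suc n) (suc j) (suc k) ≡
                    trinomialTerm n j (suc k) + trinomialTerm n (suc j) (suc k) + trinomialTerm n (suc (suc j)) k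
trinomialTerm-suc n j k = begin
  multinomial (suc n) (2 * suc k + suc j) (suc k)
    ≡⟨ cong (λ l → multinomial (suc n) l (suc k)) (+-suc (2 * suc k) j) ⟩
  multinomial (suc n) (suc i) (suc k)
    ≡⟨ multinomial-pascal n i k ⟩
  multinomial n i (suc k) + multinomial n (suc i) (suc k) + multinomial n i k
    ≡⟨ cong₂ (λ l l′ → multinomial n i (suc k) + multinomial n l (suc k) + multinomial n l′ k)
             (sym (+-suc (2 * suc k) j)) (sym (2k+[2+j]≡i k j)) ⟩
  trinomialTerm n j (suc k) + trinomialTerm n (suc j) (suc k) + trinomialTerm n (suc (suc j)) k ∎
  where
  i : ℕ
  i = 2 * suc k + j
  2k+[2+j]≡i : ∀ k j → 2 * k + suc (suc j) ≡ 2 * suc k + j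
  2k+[2+j]≡i = solve-∀

trinomialTerm-zero : ∀ n k → trinomialTerm (suc n) 0 (suc k) ≡ trinomialTerm n 0 (suc k) + 2 * trinomialTerm n 1 k
trinomialTerm-zero n k = begin
  multinomial (suc n) (2 * suc k + 0) (suc k)
    ≡⟨ cong (λ l → multinomial (suc n) l (suc k)) (2[1+k]+0≡1+i k) ⟩
  multinomial (suc n) (suc i) (suc k)
    ≡⟨ multinomial-pascal n i k ⟩
  (n C i) * (i C suc k) + multinomial n (suc i) (suc k) + multinomial n i k
    ≡⟨ cong (λ x → (n C i) * x + multinomial n (suc i) (suc k) + multinomial n i k) iC[1+k]≡iCk ⟩
  multinomial n i k + multinomial n (suc i) (suc k) + multinomial n i k
    ≡⟨ rearrange (multinomial n i k) (multinomial n (suc i) (suc k)) ⟩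
  multinomial n (suc i) (suc k) + 2 * multinomial n i k
    ≡⟨ cong (λ l → multinomial n l (suc k) + 2 * multinomial n i k) (sym (2[1+k]+0≡1+i k)) ⟩
  trinomialTerm n 0 (suc k) + 2 * trinomialTerm n 1 k ∎
  where
  i : ℕ
  i = 2 * k + 1
  2[1+k]+0≡1+i : ∀ k → 2 * suc k + 0 ≡ suc (2 * k + 1)
  2[1+k]+0≡1+i = solve-∀
  k+[1+k]≡i : ∀ k → k + suc k ≡ 2 * k + 1
  k+[1+k]≡i = solve-∀
  iC[1+k]≡iCk : i C suc k ≡ i C k
  iC[1+k]≡iCk = subst (λ l → l C suc k ≡ l C k) (k+[1+k]≡i k) (sym (C-symmetric k (suc k)))
  rearrange : ∀ a b → a + b + a ≡ b + 2 * a
  rearrange = solve-∀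

trinomial-suc : ∀ n j → trinomial (suc n) (suc j) ≡ trinomial n j + trinomial n (suc j) + trinomial n (suc (suc j))
trinomial-suc n j = begin
  ∑< (suc (suc n)) (trinomialTerm (suc n) (suc j))
    ≡⟨ ∑<-shifted (suc n) first-term (trinomialTerm-suc n j) ⟩
  ∑< (suc (suc n)) (λ k → trinomialTerm n j k + trinomialTerm n (suc j) k) + trinomial n (suc (suc j))
    ≡⟨ cong (_+ trinomial n (suc (suc j))) (∑<-+ (suc (suc n)) (trinomialTerm n j) (trinomialTerm n (suc j))) ⟩
  ∑< (suc (suc n)) (trinomialTerm n j) + ∑< (suc (suc n)) (trinomialTerm n (suc j)) + trinomial n (suc (suc j))
    ≡⟨ cong₂ (λ x y → x + y + trinomial n (suc (suc j))) (trinomial-extend n j) (trinomial-extend n (suc j)) ⟩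
  trinomial n j + trinomial n (suc j) + trinomial n (suc (suc j)) ∎
  where
  first-term : trinomialTerm (suc n) (suc j) 0 ≡ trinomialTerm n j 0 + trinomialTerm n (suc j) 0
  first-term = trans (cong (_* 1) (pascal n j)) (*-distribʳ-+ 1 (n C j) (n C suc j))

trinomial-zero : ∀ n → trinomial (suc n) 0 ≡ trinomial n 0 + 2 * trinomial n 1
trinomial-zero n = begin
  ∑< (suc (suc n)) (trinomialTerm (suc n) 0)
    ≡⟨ ∑<-shifted (suc n) refl (trinomialTerm-zero n) ⟩
  ∑< (suc (suc n)) (trinomialTerm n 0) + ∑< (suc n) (λ k → 2 * trinomialTerm n 1 k)
    ≡⟨ cong₂ _+_ (trinomial-extend n 0) (∑<-*ˡ (suc n) 2 (trinomialTerm n 1)) ⟩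
  trinomial n 0 + 2 * trinomial n 1 ∎

motzkin-trinomial : ∀ n → motzkin n + trinomial n 2 ≡ trinomial n 0
motzkin-trinomial n = begin
  motzkin n + trinomial n 2                    ≡⟨ cong₂ _+_ (sumTo≡∑< n motzkinTerm) (sym excess≡trinomial₂) ⟩
  ∑< (suc n) motzkinTerm + ∑< (suc n) excess   ≡⟨ sym (∑<-+ (suc n) motzkinTerm excess) ⟩
  ∑< (suc n) (λ k → motzkinTerm k + excess k)  ≡⟨ ∑<-cong (suc n) motzkinTerm+excess ⟩
  trinomial n 0                                ∎
  where
  motzkinTerm excess : ℕ → ℕ
  motzkinTerm k = (n C (2 * k)) * catalan k
  excess      k = (n C (2 * k)) * (2 * k C suc k)

  motzkinTerm+excess : ∀ k → motzkinTerm k + excess k ≡ trinomialTerm n 0 k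
  motzkinTerm+excess k = begin
    (n C (2 * k)) * catalan k + (n C (2 * k)) * (2 * k C suc k)
      ≡⟨ sym (*-distribˡ-+ (n C (2 * k)) (catalan k) (2 * k C suc k)) ⟩
    (n C (2 * k)) * (catalan k + 2 * k C suc k)
      ≡⟨ cong ((n C (2 * k)) *_) (catalan-difference k) ⟩
    multinomial n (2 * k) k
      ≡⟨ cong (λ i → multinomial n i k) (sym (+-identityʳ (2 * k))) ⟩
    trinomialTerm n 0 k ∎

  excess-suc : ∀ k → excess (suc k) ≡ trinomialTerm n 2 k
  excess-suc k = begin
    (n C (2 * suc k)) * (2 * suc k C suc (suc k))  ≡⟨ cong ((n C (2 * suc k)) *_) symmetric ⟩
    multinomial n (2 * suc k) k                    ≡⟨ cong (λ i → multinomial n i k) (2[1+k]≡2k+2 k) ⟩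
    trinomialTerm n 2 k                            ∎
    where
    2[1+k]≡2k+2 : ∀ k → 2 * suc k ≡ 2 * k + 2
    2[1+k]≡2k+2 = solve-∀
    k+[2+k]≡2[1+k] : ∀ k → k + suc (suc k) ≡ 2 * suc k
    k+[2+k]≡2[1+k] = solve-∀
    symmetric : 2 * suc k C suc (suc k) ≡ 2 * suc k C k
    symmetric = subst (λ l → l C suc (suc k) ≡ l C k) (k+[2+k]≡2[1+k] k) (sym (C-symmetric k (suc (suc k))))

  excess≡trinomial₂ : ∑< (suc n) excess ≡ trinomial n 2
  excess≡trinomial₂ = begin
    ∑< (suc n) excess                ≡⟨ ∑<-head n excess ⟩
    ∑< n (λ k → excess (suc k))      ≡⟨ ∑<-cong n excess-suc ⟩
    ∑< n (trinomialTerm n 2)         ≡⟨ sym (+-identityʳ (∑< n (trinomialTerm n 2))) ⟩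
    ∑< n (trinomialTerm n 2) + 0     ≡⟨ cong (∑< n (trinomialTerm n 2) +_) (sym (trinomialTerm-vanishes n 2 n n<2n+2)) ⟩
    trinomial n 2                    ∎
    where
    n+1+[1+n]≡2n+2 : ∀ n → n + 1 + suc n ≡ 2 * n + 2
    n+1+[1+n]≡2n+2 = solve-∀
    n<2n+2 : n < 2 * n + 2
    n<2n+2 = subst (n <_) (n+1+[1+n]≡2n+2 n) (m≤n+m (suc n) (n + 1))

F₃ : Set
F₃ = Fin 3

infixl 6 _⊕_ _⊖_
infixl 7 _⊗_

-- a ⊖ b adds 2b, as -1 ≡ 2 (mod 3).
_⊕_ _⊖_ _⊗_ : F₃ → F₃ → F₃
a ⊕ b = (toℕ a + toℕ b) mod 3
a ⊖ b = (toℕ a + 2 * toℕ b) mod 3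
a ⊗ b = (toℕ a * toℕ b) mod 3

[_] : ℕ → F₃
[ n ] = n mod 3

nonzero : F₃ → ℕ
nonzero 0F      = 0
nonzero (1+F _) = 1

toℕ-[] : ∀ n → toℕ [ n ] ≡ n % 3
toℕ-[] n = toℕ-fromℕ< _

[+] : ∀ m n → [ m + n ] ≡ [ m ] ⊕ [ n ]
[+] m n = toℕ-injective (begin
  toℕ [ m + n ]                ≡⟨ toℕ-[] (m + n) ⟩
  (m + n) % 3                  ≡⟨ %-distribˡ-+ m n 3 ⟩
  (m % 3 + n % 3) % 3          ≡⟨ cong₂ (λ x y → (x + y) % 3) (sym (toℕ-[] m)) (sym (toℕ-[] n)) ⟩
  (toℕ [ m ] + toℕ [ n ]) % 3  ≡⟨ sym (toℕ-[] (toℕ [ m ] + toℕ [ n ])) ⟩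
  toℕ ([ m ] ⊕ [ n ])          ∎)

[*] : ∀ m n → [ m * n ] ≡ [ m ] ⊗ [ n ]
[*] m n = toℕ-injective (begin
  toℕ [ m * n ]                ≡⟨ toℕ-[] (m * n) ⟩
  (m * n) % 3                  ≡⟨ %-distribˡ-* m n 3 ⟩
  (m % 3 * (n % 3)) % 3        ≡⟨ cong₂ (λ x y → (x * y) % 3) (sym (toℕ-[] m)) (sym (toℕ-[] n)) ⟩
  (toℕ [ m ] * toℕ [ n ]) % 3  ≡⟨ sym (toℕ-[] (toℕ [ m ] * toℕ [ n ])) ⟩
  toℕ ([ m ] ⊗ [ n ])          ∎)

[+₃] : ∀ a b c → [ a + b + c ] ≡ [ a ] ⊕ [ b ] ⊕ [ c ]
[+₃] a b c = trans ([+] (a + b) c) (cong (_⊕ [ c ]) ([+] a b))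

[]≡0⇒3∣ : ∀ n → [ n ] ≡ 0F → 3 ∣ n
[]≡0⇒3∣ n [n]≡0 = m%n≡0⇒n∣m n 3 (trans (sym (toℕ-[] n)) (cong toℕ [n]≡0))

3∣⇒[]≡0 : ∀ n → 3 ∣ n → [ n ] ≡ 0F
3∣⇒[]≡0 n 3∣n = toℕ-injective (trans (toℕ-[] n) (n∣m⇒m%n≡0 n 3 3∣n))

⊗-zeroʳ : ∀ x → x ⊗ 0F ≡ 0F
⊗-zeroʳ = from-yes (all? λ x → x ⊗ 0F ≟₃ 0F)

⊗-distribˡ-⊕ : ∀ x y z → x ⊗ (y ⊕ z) ≡ x ⊗ y ⊕ x ⊗ z
⊗-distribˡ-⊕ = from-yes (all? λ x → all? λ y → all? λ z → x ⊗ (y ⊕ z) ≟₃ x ⊗ y ⊕ x ⊗ z)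

nonzero≤1 : ∀ x → nonzero x ≤ 1
nonzero≤1 0F      = z≤n
nonzero≤1 (1+F _) = s≤s z≤n

nonzero-⊗ˡ : ∀ x y → nonzero (x ⊗ y) ≤ nonzero x
nonzero-⊗ˡ = from-yes (all? λ x → all? λ y → nonzero (x ⊗ y) ≤? nonzero x)

nonzero-⊗ʳ : ∀ x y → nonzero (x ⊗ y) ≤ nonzero y
nonzero-⊗ʳ = from-yes (all? λ x → all? λ y → nonzero (x ⊗ y) ≤? nonzero y)

nonzero-⊖ : ∀ x y → nonzero (x ⊖ y) ≤ nonzero x + nonzero y
nonzero-⊖ = from-yes (all? λ x → all? λ y → nonzero (x ⊖ y) ≤? nonzero x + nonzero y)

-- (-1)ⁿ, with 2 standing for -1
sign : ℕ → F₃
sign zero    = [ 1 ]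
sign (suc n) = [ 2 ] ⊗ sign n

nonzero-sign⊗ : ∀ n x → nonzero (sign n ⊗ x) ≡ nonzero x
nonzero-sign⊗ zero    x = cong nonzero (1⊗x≡x x)
  where
  1⊗x≡x : ∀ x → [ 1 ] ⊗ x ≡ x
  1⊗x≡x = from-yes (all? λ x → [ 1 ] ⊗ x ≟₃ x)
nonzero-sign⊗ (suc n) x = trans (nonzero-2⊗ (sign n) x) (nonzero-sign⊗ n x)
  where
  nonzero-2⊗ : ∀ s x → nonzero (([ 2 ] ⊗ s) ⊗ x) ≡ nonzero (s ⊗ x)
  nonzero-2⊗ = from-yes (all? λ s → all? λ x → nonzero (([ 2 ] ⊗ s) ⊗ x) ≟ nonzero (s ⊗ x))

[pascal] : ∀ m k → [ suc m C suc k ] ≡ [ m C k ] ⊕ [ m C suc k ]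
[pascal] m k = trans (cong [_] (pascal m k)) ([+] (m C k) (m C suc k))

[pascal²] : ∀ m k → [ suc (suc m) C suc (suc k) ] ≡ [ m C k ] ⊕ [ 2 ] ⊗ [ m C suc k ] ⊕ [ m C suc (suc k) ]
[pascal²] m k = begin
  [ suc (suc m) C suc (suc k) ]
    ≡⟨ cong [_] (pascal² m k) ⟩
  [ m C k + 2 * (m C suc k) + m C suc (suc k) ]
    ≡⟨ [+₃] (m C k) (2 * (m C suc k)) (m C suc (suc k)) ⟩
  [ m C k ] ⊕ [ 2 * (m C suc k) ] ⊕ [ m C suc (suc k) ]
    ≡⟨ cong (λ x → [ m C k ] ⊕ x ⊕ [ m C suc (suc k) ]) ([*] 2 (m C suc k)) ⟩
  [ m C k ] ⊕ [ 2 ] ⊗ [ m C suc k ] ⊕ [ m C suc (suc k) ] ∎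

trinomial-mod3 : ∀ n j → [ trinomial n j ] ≡ sign (j + n) ⊗ [ 2 * n C (j + n) ]
trinomial-mod3 zero    zero    = refl
trinomial-mod3 zero    (suc j) = sym (⊗-zeroʳ (sign (suc (j + 0))))
trinomial-mod3 (suc n) zero    = begin
  [ trinomial (suc n) 0 ]
    ≡⟨ cong [_] (trinomial-zero n) ⟩
  [ trinomial n 0 + 2 * trinomial n 1 ]
    ≡⟨ [+] (trinomial n 0) (2 * trinomial n 1) ⟩
  [ trinomial n 0 ] ⊕ [ 2 * trinomial n 1 ]
    ≡⟨ cong ([ trinomial n 0 ] ⊕_) ([*] 2 (trinomial n 1)) ⟩
  [ trinomial n 0 ] ⊕ [ 2 ] ⊗ [ trinomial n 1 ]
    ≡⟨ cong₂ (λ x y → x ⊕ [ 2 ] ⊗ y) (trinomial-mod3 n 0) (trinomial-mod3 n 1) ⟩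
  σ ⊗ a ⊕ [ 2 ] ⊗ (([ 2 ] ⊗ σ) ⊗ b)
    ≡⟨ alternating-sum σ a b ⟩
  ([ 2 ] ⊗ σ) ⊗ ([ 2 ] ⊗ a ⊕ [ 2 ] ⊗ b)
    ≡⟨ cong (([ 2 ] ⊗ σ) ⊗_) (sym [central-pascal]) ⟩
  sign (suc n) ⊗ [ 2 * suc n C suc n ] ∎
  where
  σ a b : F₃
  σ = sign n
  a = [ 2 * n C n ]
  b = [ 2 * n C suc n ]
  alternating-sum : ∀ σ a b → σ ⊗ a ⊕ [ 2 ] ⊗ (([ 2 ] ⊗ σ) ⊗ b) ≡
                              ([ 2 ] ⊗ σ) ⊗ ([ 2 ] ⊗ a ⊕ [ 2 ] ⊗ b)
  alternating-sum = from-yes (all? λ σ → all? λ a → all? λ b →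
    σ ⊗ a ⊕ [ 2 ] ⊗ (([ 2 ] ⊗ σ) ⊗ b) ≟₃ ([ 2 ] ⊗ σ) ⊗ ([ 2 ] ⊗ a ⊕ [ 2 ] ⊗ b))
  [central-pascal] : [ 2 * suc n C suc n ] ≡ [ 2 ] ⊗ a ⊕ [ 2 ] ⊗ b
  [central-pascal] = begin
    [ 2 * suc n C suc n ]                          ≡⟨ cong [_] (central-pascal n) ⟩
    [ 2 * (2 * n C n) + 2 * (2 * n C suc n) ]      ≡⟨ [+] (2 * (2 * n C n)) (2 * (2 * n C suc n)) ⟩
    [ 2 * (2 * n C n) ] ⊕ [ 2 * (2 * n C suc n) ]  ≡⟨ cong₂ _⊕_ ([*] 2 (2 * n C n)) ([*] 2 (2 * n C suc n)) ⟩
    [ 2 ] ⊗ a ⊕ [ 2 ] ⊗ b                          ∎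
trinomial-mod3 (suc n) (suc j) rewrite +-suc j n = begin
  [ trinomial (suc n) (suc j) ]
    ≡⟨ cong [_] (trinomial-suc n j) ⟩
  [ trinomial n j + trinomial n (suc j) + trinomial n (suc (suc j)) ]
    ≡⟨ [+₃] (trinomial n j) (trinomial n (suc j)) (trinomial n (suc (suc j))) ⟩
  [ trinomial n j ] ⊕ [ trinomial n (suc j) ] ⊕ [ trinomial n (suc (suc j)) ]
    ≡⟨ cong₂ _⊕_ (cong₂ _⊕_ (trinomial-mod3 n j) (trinomial-mod3 n (suc j))) (trinomial-mod3 n (suc (suc j))) ⟩
  σ ⊗ a ⊕ ([ 2 ] ⊗ σ) ⊗ b ⊕ ([ 2 ] ⊗ ([ 2 ] ⊗ σ)) ⊗ c
    ≡⟨ alternating-sum σ a b c ⟩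
  ([ 2 ] ⊗ ([ 2 ] ⊗ σ)) ⊗ (a ⊕ [ 2 ] ⊗ b ⊕ c)
    ≡⟨ cong (([ 2 ] ⊗ ([ 2 ] ⊗ σ)) ⊗_) (sym [pascal²]′) ⟩
  sign (suc (suc i)) ⊗ [ 2 * suc n C suc (suc i) ] ∎
  where
  i : ℕ
  i = j + n
  σ a b c : F₃
  σ = sign i
  a = [ 2 * n C i ]
  b = [ 2 * n C suc i ]
  c = [ 2 * n C suc (suc i) ]
  alternating-sum : ∀ σ a b c → σ ⊗ a ⊕ ([ 2 ] ⊗ σ) ⊗ b ⊕ ([ 2 ] ⊗ ([ 2 ] ⊗ σ)) ⊗ c ≡
                                ([ 2 ] ⊗ ([ 2 ] ⊗ σ)) ⊗ (a ⊕ [ 2 ] ⊗ b ⊕ c)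
  alternating-sum = from-yes (all? λ σ → all? λ a → all? λ b → all? λ c →
    σ ⊗ a ⊕ ([ 2 ] ⊗ σ) ⊗ b ⊕ ([ 2 ] ⊗ ([ 2 ] ⊗ σ)) ⊗ c
      ≟₃ ([ 2 ] ⊗ ([ 2 ] ⊗ σ)) ⊗ (a ⊕ [ 2 ] ⊗ b ⊕ c))
  2[1+n]≡2+2n : ∀ n → 2 * suc n ≡ suc (suc (2 * n))
  2[1+n]≡2+2n = solve-∀
  [pascal²]′ : [ 2 * suc n C suc (suc i) ] ≡ a ⊕ [ 2 ] ⊗ b ⊕ c
  [pascal²]′ = trans (cong (λ m → [ m C suc (suc i) ]) (2[1+n]≡2+2n n)) ([pascal²] (2 * n) i)

motzkin-mod3 : ∀ n → [ motzkin n ] ≡ sign n ⊗ ([ 2 * n C n ] ⊖ [ 2 * n C (2 + n) ])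
motzkin-mod3 n = begin
  [ motzkin n ]
    ≡⟨ sym (⊕-⊖-cancel [ motzkin n ] [ trinomial n 2 ]) ⟩
  [ motzkin n ] ⊕ [ trinomial n 2 ] ⊖ [ trinomial n 2 ]
    ≡⟨ cong (_⊖ [ trinomial n 2 ]) (sym ([+] (motzkin n) (trinomial n 2))) ⟩
  [ motzkin n + trinomial n 2 ] ⊖ [ trinomial n 2 ]
    ≡⟨ cong (λ x → [ x ] ⊖ [ trinomial n 2 ]) (motzkin-trinomial n) ⟩
  [ trinomial n 0 ] ⊖ [ trinomial n 2 ]
    ≡⟨ cong₂ _⊖_ (trinomial-mod3 n 0) (trinomial-mod3 n 2) ⟩
  sign n ⊗ a ⊖ ([ 2 ] ⊗ ([ 2 ] ⊗ sign n)) ⊗ b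
    ≡⟨ factor (sign n) a b ⟩
  sign n ⊗ (a ⊖ b) ∎
  where
  a b : F₃
  a = [ 2 * n C n ]
  b = [ 2 * n C (2 + n) ]
  ⊕-⊖-cancel : ∀ x y → x ⊕ y ⊖ y ≡ x
  ⊕-⊖-cancel = from-yes (all? λ x → all? λ y → x ⊕ y ⊖ y ≟₃ x)
  factor : ∀ σ a b → σ ⊗ a ⊖ ([ 2 ] ⊗ ([ 2 ] ⊗ σ)) ⊗ b ≡ σ ⊗ (a ⊖ b)
  factor = from-yes (all? λ σ → all? λ a → all? λ b →
    σ ⊗ a ⊖ ([ 2 ] ⊗ ([ 2 ] ⊗ σ)) ⊗ b ≟₃ σ ⊗ (a ⊖ b))

LucasRow : ℕ → ℕ → ℕ → Set
LucasRow m a b = ∀ c d → d < 3 → [ m C (3 * c + d) ] ≡ [ a C c ] ⊗ [ b C d ]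

lucasRow-next-digit : ∀ {m a b} c d → suc d < 3 → LucasRow m a b →
                      [ suc m C (3 * c + suc d) ] ≡ [ a C c ] ⊗ [ suc b C suc d ]
lucasRow-next-digit {m} {a} {b} c d 1+d<3 row = begin
  [ suc m C (3 * c + suc d) ]                        ≡⟨ cong (λ k → [ suc m C k ]) (+-suc (3 * c) d) ⟩
  [ suc m C suc (3 * c + d) ]                        ≡⟨ [pascal] m (3 * c + d) ⟩
  [ m C (3 * c + d) ] ⊕ [ m C suc (3 * c + d) ]      ≡⟨ cong₂ _⊕_ (row c d (<-trans (n<1+n d) 1+d<3)) next ⟩
  [ a C c ] ⊗ [ b C d ] ⊕ [ a C c ] ⊗ [ b C suc d ]  ≡⟨ sym (⊗-distribˡ-⊕ [ a C c ] [ b C d ] [ b C suc d ]) ⟩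
  [ a C c ] ⊗ ([ b C d ] ⊕ [ b C suc d ])            ≡⟨ cong ([ a C c ] ⊗_) (sym ([pascal] b d)) ⟩
  [ a C c ] ⊗ [ suc b C suc d ]                      ∎
  where
  next : [ m C suc (3 * c + d) ] ≡ [ a C c ] ⊗ [ b C suc d ]
  next = trans (cong (λ k → [ m C k ]) (sym (+-suc (3 * c) d))) (row c (suc d) 1+d<3)

lucasRow-carry : ∀ {m a b} c → LucasRow m a b →
                 [ suc m C (3 * suc c + 0) ] ≡ [ a C c ] ⊗ [ b C 2 ] ⊕ [ a C suc c ] ⊗ [ b C 0 ]
lucasRow-carry {m} {a} {b} c row = begin
  [ suc m C (3 * suc c + 0) ]                        ≡⟨ cong (λ k → [ suc m C k ]) (3[1+c]+0≡1+[3c+2] c) ⟩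
  [ suc m C suc (3 * c + 2) ]                        ≡⟨ [pascal] m (3 * c + 2) ⟩
  [ m C (3 * c + 2) ] ⊕ [ m C suc (3 * c + 2) ]      ≡⟨ cong₂ _⊕_ (row c 2 (s<s (s<s z<s))) next ⟩
  [ a C c ] ⊗ [ b C 2 ] ⊕ [ a C suc c ] ⊗ [ b C 0 ]  ∎
  where
  3[1+c]+0≡1+[3c+2] : ∀ c → 3 * suc c + 0 ≡ suc (3 * c + 2)
  3[1+c]+0≡1+[3c+2] = solve-∀
  next : [ m C suc (3 * c + 2) ] ≡ [ a C suc c ] ⊗ [ b C 0 ]
  next = trans (cong (λ k → [ m C k ]) (sym (3[1+c]+0≡1+[3c+2] c))) (row (suc c) 0 z<s)

lucasRow-suc : ∀ {m a b} → b < 2 → LucasRow m a b → LucasRow (suc m) a (suc b)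
lucasRow-suc             _   _   zero    zero    _     = refl
lucasRow-suc {m} {a} {b} b<2 row (suc c) zero    _     = begin
  [ suc m C (3 * suc c + 0) ]                    ≡⟨ lucasRow-carry c row ⟩
  [ a C c ] ⊗ [ b C 2 ] ⊕ [ a C suc c ] ⊗ [ 1 ]  ≡⟨ cong (λ x → [ a C c ] ⊗ [ x ] ⊕ [ a C suc c ] ⊗ [ 1 ])
                                                          (k>n⇒nCk≡0 b<2) ⟩
  [ a C c ] ⊗ 0F ⊕ [ a C suc c ] ⊗ [ 1 ]         ≡⟨ drop [ a C c ] ([ a C suc c ] ⊗ [ 1 ]) ⟩
  [ a C suc c ] ⊗ [ 1 ]                          ∎
  where
  drop : ∀ x y → x ⊗ 0F ⊕ y ≡ y
  drop = from-yes (all? λ x → all? λ y → x ⊗ 0F ⊕ y ≟₃ y)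
lucasRow-suc             _   row c       (suc d) 1+d<3 = lucasRow-next-digit c d 1+d<3 row

lucasRow-carry-suc : ∀ {m a} → LucasRow m a 2 → LucasRow (suc m) (suc a) 0
lucasRow-carry-suc         _   zero    zero                _  = refl
lucasRow-carry-suc {m} {a} row (suc c) zero                _  = begin
  [ suc m C (3 * suc c + 0) ]                ≡⟨ lucasRow-carry c row ⟩
  [ a C c ] ⊗ [ 1 ] ⊕ [ a C suc c ] ⊗ [ 1 ]  ≡⟨ collect [ a C c ] [ a C suc c ] ⟩
  ([ a C c ] ⊕ [ a C suc c ]) ⊗ [ 1 ]        ≡⟨ cong (_⊗ [ 1 ]) (sym ([pascal] a c)) ⟩
  [ suc a C suc c ] ⊗ [ 1 ]                  ∎
  where
  collect : ∀ x y → x ⊗ [ 1 ] ⊕ y ⊗ [ 1 ] ≡ (x ⊕ y) ⊗ [ 1 ]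
  collect = from-yes (all? λ x → all? λ y → x ⊗ [ 1 ] ⊕ y ⊗ [ 1 ] ≟₃ (x ⊕ y) ⊗ [ 1 ])
lucasRow-carry-suc {a = a} row c     (suc zero)          lt =
  trans (lucasRow-next-digit c 0 lt row) (trans (⊗-zeroʳ [ a C c ]) (sym (⊗-zeroʳ [ suc a C c ])))
lucasRow-carry-suc {a = a} row c     (suc (suc zero))    lt =
  trans (lucasRow-next-digit c 1 lt row) (trans (⊗-zeroʳ [ a C c ]) (sym (⊗-zeroʳ [ suc a C c ])))
lucasRow-carry-suc         _   _     (suc (suc (suc _))) (s<s (s<s (s<s ())))

lucasRow : ∀ a b → b < 3 → LucasRow (3 * a + b) a b
lucasRow zero    zero                _ = origin
  where
  origin : LucasRow 0 0 0
  origin zero    zero    _ = refl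
  origin zero    (suc d) _ = refl
  origin (suc c) d       _ = refl
lucasRow (suc a) zero                _ = subst (λ m → LucasRow m (suc a) 0) (sym (3[1+a]+0≡1+[3a+2] a))
                                               (lucasRow-carry-suc (lucasRow a 2 (s<s (s<s z<s))))
  where
  3[1+a]+0≡1+[3a+2] : ∀ a → 3 * suc a + 0 ≡ suc (3 * a + 2)
  3[1+a]+0≡1+[3a+2] = solve-∀
lucasRow a       (suc zero)          _ = subst (λ m → LucasRow m a 1) (sym (+-suc (3 * a) 0))
                                               (lucasRow-suc z<s (lucasRow a 0 z<s))
lucasRow a       (suc (suc zero))    _ = subst (λ m → LucasRow m a 2) (sym (+-suc (3 * a) 1))
                                               (lucasRow-suc (s<s z<s) (lucasRow a 1 (s<s z<s)))
lucasRow _       (suc (suc (suc _))) (s<s (s<s (s<s ())))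

lucas : ∀ a b c d → b < 3 → d < 3 → [ (3 * a + b) C (3 * c + d) ] ≡ [ a C c ] ⊗ [ b C d ]
lucas a b c d b<3 = lucasRow a b b<3 c d

nearCentral : ℕ → ℕ → ℕ → F₃
nearCentral u v m = [ (u + 2 * m) C (v + m) ]

nearCentral-digit : ∀ u v r a → nearCentral u v (r + 3 * a) ≡
                    nearCentral ((u + 2 * r) / 3) ((v + r) / 3) a ⊗ [ ((u + 2 * r) % 3) C ((v + r) % 3) ]
nearCentral-digit u v r a = begin
  [ (u + 2 * (r + 3 * a)) C (v + (r + 3 * a)) ]
    ≡⟨ cong₂ (λ n k → [ n C k ]) top bottom ⟩
  [ (3 * (q + 2 * a) + s) C (3 * (p + a) + t) ]
    ≡⟨ lucas (q + 2 * a) s (p + a) t (m%n<n (u + 2 * r) 3) (m%n<n (v + r) 3) ⟩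
  nearCentral q p a ⊗ [ s C t ] ∎
  where
  q s p t : ℕ
  q = (u + 2 * r) / 3
  s = (u + 2 * r) % 3
  p = (v + r) / 3
  t = (v + r) % 3
  top : u + 2 * (r + 3 * a) ≡ 3 * (q + 2 * a) + s
  top = begin
    u + 2 * (r + 3 * a)  ≡⟨ pull-6a u r a ⟩
    u + 2 * r + 6 * a    ≡⟨ cong (_+ 6 * a) (m≡m%n+[m/n]*n (u + 2 * r) 3) ⟩
    s + q * 3 + 6 * a    ≡⟨ push-6a q s a ⟩
    3 * (q + 2 * a) + s  ∎
    where
    pull-6a : ∀ u r a → u + 2 * (r + 3 * a) ≡ u + 2 * r + 6 * a
    pull-6a = solve-∀
    push-6a : ∀ q s a → s + q * 3 + 6 * a ≡ 3 * (q + 2 * a) + s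
    push-6a = solve-∀
  bottom : v + (r + 3 * a) ≡ 3 * (p + a) + t
  bottom = begin
    v + (r + 3 * a)    ≡⟨ sym (+-assoc v r (3 * a)) ⟩
    v + r + 3 * a      ≡⟨ cong (_+ 3 * a) (m≡m%n+[m/n]*n (v + r) 3) ⟩
    t + p * 3 + 3 * a  ≡⟨ push-3a p t a ⟩
    3 * (p + a) + t    ∎
    where
    push-3a : ∀ p t a → t + p * 3 + 3 * a ≡ 3 * (p + a) + t
    push-3a = solve-∀

nonzero-digitˡ : ∀ u v r a →
                 nonzero (nearCentral u v (r + 3 * a)) ≤ nonzero (nearCentral ((u + 2 * r) / 3) ((v + r) / 3) a)
nonzero-digitˡ u v r a = subst (_≤ nonzero x) (sym (cong nonzero (nearCentral-digit u v r a))) (nonzero-⊗ˡ x y)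
  where
  x y : F₃
  x = nearCentral ((u + 2 * r) / 3) ((v + r) / 3) a
  y = [ ((u + 2 * r) % 3) C ((v + r) % 3) ]

nonzero-digitʳ : ∀ u v r a →
                 nonzero (nearCentral u v (r + 3 * a)) ≤ nonzero [ ((u + 2 * r) % 3) C ((v + r) % 3) ]
nonzero-digitʳ u v r a = subst (_≤ nonzero y) (sym (cong nonzero (nearCentral-digit u v r a))) (nonzero-⊗ʳ x y)
  where
  x y : F₃
  x = nearCentral ((u + 2 * r) / 3) ((v + r) / 3) a
  y = [ ((u + 2 * r) % 3) C ((v + r) % 3) ]

nonzeroCount : ℕ → ℕ → ℕ → ℕ
nonzeroCount u v n = ∑< n (λ m → nonzero (nearCentral u v m))

nonzeroCount-00 : ∀ j → nonzeroCount 0 0 (3 ^ j) ≤ 2 ^ j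
nonzeroCount-00 zero    = nonzero≤1 (nearCentral 0 0 0)
nonzeroCount-00 (suc j) = ≤-trans
  (∑<-digits (nonzero-digitˡ 0 0 0) (nonzero-digitˡ 0 0 1) (nonzero-digitʳ 0 0 2) (3 ^ j))
  (≤-trans (+-mono-≤ (+-mono-≤ (nonzeroCount-00 j) (nonzeroCount-00 j)) (≤-reflexive (∑<-zero (3 ^ j))))
           (≤-reflexive (x+x+0≡2x (2 ^ j))))
  where
  x+x+0≡2x : ∀ x → x + x + 0 ≡ 2 * x
  x+x+0≡2x = solve-∀

nonzeroCount-11 : ∀ j → nonzeroCount 1 1 (3 ^ j) ≤ 2 ^ j
nonzeroCount-11 zero    = nonzero≤1 (nearCentral 1 1 0)
nonzeroCount-11 (suc j) = ≤-trans
  (∑<-digits (nonzero-digitˡ 1 1 0) (nonzero-digitʳ 1 1 1) (nonzero-digitˡ 1 1 2) (3 ^ j))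
  (≤-trans (+-mono-≤ (+-mono-≤ (nonzeroCount-00 j) (≤-reflexive (∑<-zero (3 ^ j)))) (nonzeroCount-11 j))
           (≤-reflexive (x+0+x≡2x (2 ^ j))))
  where
  x+0+x≡2x : ∀ x → x + 0 + x ≡ 2 * x
  x+0+x≡2x = solve-∀

nonzeroCount-01 : ∀ j → nonzeroCount 0 1 (3 ^ j) ≤ 2 ^ j
nonzeroCount-01 zero    = nonzero≤1 (nearCentral 0 1 0)
nonzeroCount-01 (suc j) = ≤-trans
  (∑<-digits (nonzero-digitʳ 0 1 0) (nonzero-digitˡ 0 1 1) (nonzero-digitˡ 0 1 2) (3 ^ j))
  (≤-trans (+-mono-≤ (+-mono-≤ (≤-reflexive (∑<-zero (3 ^ j))) (nonzeroCount-00 j)) (nonzeroCount-11 j))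
           (≤-reflexive (0+x+x≡2x (2 ^ j))))
  where
  0+x+x≡2x : ∀ x → 0 + x + x ≡ 2 * x
  0+x+x≡2x = solve-∀

nonzeroCount-02 : ∀ j → nonzeroCount 0 2 (3 ^ suc j) ≤ 2 ^ suc j
nonzeroCount-02 j = ≤-trans
  (∑<-digits (nonzero-digitʳ 0 2 0) (nonzero-digitˡ 0 2 1) (nonzero-digitˡ 0 2 2) (3 ^ j))
  (≤-trans (+-mono-≤ (+-mono-≤ (≤-reflexive (∑<-zero (3 ^ j))) (nonzeroCount-01 j)) (nonzeroCount-11 j))
           (≤-reflexive (0+x+x≡2x (2 ^ j))))
  where
  0+x+x≡2x : ∀ x → 0 + x + x ≡ 2 * x
  0+x+x≡2x = solve-∀

nonzero-motzkin : ∀ n → nonzero [ motzkin n ] ≤ nonzero (nearCentral 0 0 n) + nonzero (nearCentral 0 2 n)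
nonzero-motzkin n = subst (_≤ nonzero a + nonzero b) (sym nonzero-[motzkin]) (nonzero-⊖ a b)
  where
  a b : F₃
  a = nearCentral 0 0 n
  b = nearCentral 0 2 n
  nonzero-[motzkin] : nonzero [ motzkin n ] ≡ nonzero (a ⊖ b)
  nonzero-[motzkin] = trans (cong nonzero (motzkin-mod3 n)) (nonzero-sign⊗ n (a ⊖ b))

nonzeroMotzkinCount : ℕ → ℕ
nonzeroMotzkinCount n = ∑< n (λ m → nonzero [ motzkin m ])

nonzeroMotzkinCount-bound : ∀ j → nonzeroMotzkinCount (3 ^ suc j) ≤ 4 * 2 ^ j
nonzeroMotzkinCount-bound j = ≤-trans (∑<-mono (3 ^ suc j) nonzero-motzkin) (≤-trans
  (≤-reflexive (∑<-+ (3 ^ suc j) (λ n → nonzero (nearCentral 0 0 n)) (λ n → nonzero (nearCentral 0 2 n))))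
  (≤-trans (+-mono-≤ (nonzeroCount-00 (suc j)) (nonzeroCount-02 j)) (≤-reflexive (2x+2x≡4x (2 ^ j)))))
  where
  2x+2x≡4x : ∀ x → 2 * x + 2 * x ≡ 4 * x
  2x+2x≡4x = solve-∀

ind3+nonzero : ∀ n → ind3 n + nonzero [ motzkin n ] ≡ 1
ind3+nonzero n with 3 ∣? motzkin n
... | yes 3∣M = cong (λ x → 1 + nonzero x) (3∣⇒[]≡0 (motzkin n) 3∣M)
... | no  3∤M with [ motzkin n ] in [M]≡x
...   | 0F    = contradiction ([]≡0⇒3∣ (motzkin n) [M]≡x) 3∤M
...   | 1+F _ = refl

count+nonzeroMotzkinCount : ∀ N → count N + nonzeroMotzkinCount (suc N) ≡ suc N
count+nonzeroMotzkinCount N = begin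
  sumTo N ind3 + nonzeroMotzkinCount (suc N)
    ≡⟨ cong (_+ nonzeroMotzkinCount (suc N)) (sumTo≡∑< N ind3) ⟩
  ∑< (suc N) ind3 + ∑< (suc N) (λ m → nonzero [ motzkin m ])
    ≡⟨ sym (∑<-+ (suc N) ind3 (λ m → nonzero [ motzkin m ])) ⟩
  ∑< (suc N) (λ m → ind3 m + nonzero [ motzkin m ])
    ≡⟨ ∑<-cong (suc N) ind3+nonzero ⟩
  ∑< (suc N) (λ _ → 1)
    ≡⟨ trans (∑<-const (suc N) 1) (*-identityʳ (suc N)) ⟩
  suc N ∎

∣count-N∣<nonzeroMotzkinCount : ∀ N → ∣ count N - N ∣ < nonzeroMotzkinCount (suc N)
∣count-N∣<nonzeroMotzkinCount N = m+o≡1+n⇒∣m-n∣<o (count N) N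
  (∑<-monoˡ (λ m → nonzero [ motzkin m ]) {1} {suc N} (s≤s z≤n)) (count+nonzeroMotzkinCount N)

theorem8 : (k : ℕ) → Σ ℕ (λ N₀ → (N : ℕ) → N₀ ≤ N → suc k * ∣ count N - N ∣ < N)
theorem8 k = 3 ^ (2 * K) , density
  where
  K : ℕ
  K = 4 * suc k
  density : (N : ℕ) → 3 ^ (2 * K) ≤ N → suc k * ∣ count N - N ∣ < N
  density N 3^2K≤N with base3-bracket N (≤-trans (m^n>0 3 (2 * K)) 3^2K≤N)
  ... | j , 3^j≤N , N<3^[1+j] =
    <-≤-trans (*-monoʳ-< (suc k) (∣count-N∣<nonzeroMotzkinCount N))
      (≤-trans (*-monoʳ-≤ (suc k) few-nonzero)
        (≤-trans (≤-reflexive (regroup k (2 ^ j))) (≤-trans (K*2^n≤3^n K j 2K≤j) 3^j≤N)))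
    where
    few-nonzero : nonzeroMotzkinCount (suc N) ≤ 4 * 2 ^ j
    few-nonzero = ≤-trans (∑<-monoˡ (λ m → nonzero [ motzkin m ]) N<3^[1+j]) (nonzeroMotzkinCount-bound j)
    2K≤j : 2 * K ≤ j
    2K≤j = ≮⇒≥ λ j<2K → <⇒≱ N<3^[1+j] (≤-trans (^-monoʳ-≤ 3 j<2K) 3^2K≤N)
    regroup : ∀ k x → suc k * (4 * x) ≡ 4 * suc k * x
    regroup = solve-∀
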